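{- Let $n\ge2$, $\sigma,\tau\in\mathfrak{S}_n$ with $\tau\lessdot\sigma$, say $\tau s_i=\sigma$ with $i\in\mathrm{Des}(\sigma)$, and regard $G(\tau)$ as the induced subgraph of $G(\sigma)$ on the vertex set $\{ti:t\in\mathcal{R}(\tau)\}$. (1) If $i-1,i,i+1\in\mathrm{Des}(\sigma)$, then the number of braid edges incident to vertices of $G(\tau)$ but not contained in $G(\tau)$ is $|\mathcal{R}(\sigma s_is_{i+1}s_i)|+|\mathcal{R}(\sigma s_is_{i-1}s_i)|$. (2) If $i,i+1\in\mathrm{Des}(\sigma)$ but $i-1\notin\mathrm{Des}(\sigma)$, then this number is $|\mathcal{R}(\sigma s_is_{i+1}s_i)|$ (and analogously, if $i-1,i\in\mathrm{Des}(\sigma)$ but $i+1\notin\mathrm{Des}(\sigma)$, it is $|\mathcal{R}(\sigma s_is_{i-1}s_i)|$). (3) Otherwise, every braid edge incident to a vertex of $G(\tau)$ has both endpoints in $G(\tau)$.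
   Context: $\mathfrak{S}_n$ is the symmetric group on $[n]$ with simple transpositions $s_i=(i\ i+1)$; $\ell$ is the inversion number; $\mathcal{R}(\sigma)$ is the set of reduced words of $\sigma$ (words $i_1\cdots i_l$ with $l=\ell(\sigma)$ and $\sigma=s_{i_1}\cdots s_{i_l}$); $\mathrm{Des}(\sigma)=\{i:\sigma(i)>\sigma(i+1)\}$; $\tau\lessdot\sigma$ means $\sigma=\tau s_i$ with $\ell(\sigma)=\ell(\tau)+1$. $G(\sigma)$ is the graph on $\mathcal{R}(\sigma)$ with commutation edges joining words related by a single move $ab\to ba$ on adjacent letters with $|a-b|>1$, and braid edges joining words related by a single move $a(a+1)a\leftrightarrow(a+1)a(a+1)$ on adjacent letters. -}

module Defs where

open import Data.Nat using (ℕ; zero; suc; _+_; _∸_; _≤_; _<_; _<?_; _≟_)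
open import Data.List using (List; []; _∷_; _++_; map; length; filter; applyUpTo; concatMap; foldl; cartesianProduct; [_]; _∷ʳ_)
open import Data.List.Properties using (≡-dec)
open import Data.List.Membership.Propositional using (_∈_; _∉_)
open import Data.List.Membership.DecPropositional (≡-dec _≟_) using (_∈?_)
open import Data.List.Relation.Binary.Permutation.Propositional using (_↭_)
open import Data.Product using (_×_; _,_)
open import Data.Bool using (if_then_else_; _∧_; _∨_)
open import Relation.Nullary using (¬_; Dec)
open import Relation.Nullary.Decidable using (⌊_⌋; _×-dec_; ¬?)
open import Relation.Binary.PropositionalEquality using (_≡_)

-- Permutations of [n] in one-line notation: σ = [σ(1), …, σ(n)].
iota : ℕ → List ℕ
iota n = applyUpTo suc n

IsPerm : ℕ → List ℕ → Set
IsPerm n σ = σ ↭ iota n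

-- 1-indexed entry σ(k) (k = 1..length σ); 0 outside the range.
nth : List ℕ → ℕ → ℕ
nth []       _       = 0
nth (x ∷ xs) zero    = x
nth (x ∷ xs) (suc k) = nth xs k

at : List ℕ → ℕ → ℕ
at σ k = nth σ (k ∸ 1)

-- Swap positions i and i+1 (1-indexed) of a list.
swapAt : ℕ → List ℕ → List ℕ
swapAt zero          xs           = xs
swapAt (suc zero)    (x ∷ y ∷ xs) = y ∷ x ∷ xs
swapAt (suc zero)    xs           = xs
swapAt (suc (suc k)) []           = []
swapAt (suc (suc k)) (x ∷ xs)     = x ∷ swapAt (suc k) xs

-- Right multiplication by s_i: (σ s_i)(j) = σ(s_i(j)), i.e. swap positions i, i+1.
rmul : List ℕ → ℕ → List ℕ
rmul σ i = swapAt i σ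

eval : ℕ → List ℕ → List ℕ
eval n w = foldl rmul (iota n) w

inv : List ℕ → ℕ
inv []       = 0
inv (x ∷ xs) = length (filter (λ y → y <? x) xs) + inv xs

InDes : List ℕ → ℕ → Set
InDes σ i = (1 ≤ i) × (suc i ≤ length σ) × (at σ (suc i) < at σ i)

letters : ℕ → List ℕ
letters n = applyUpTo suc (n ∸ 1)

allWords : ℕ → ℕ → List (List ℕ)
allWords n zero    = [] ∷ []
allWords n (suc l) = concatMap (λ a → map (a ∷_) (allWords n l)) (letters n)

R : ℕ → List ℕ → List (List ℕ)
R n σ = filter (λ w → ≡-dec _≟_ (eval n w) σ) (allWords n (inv σ))

numR : ℕ → List ℕ → ℕ
numR n σ = length (R n σ)

-- All words obtained from a word by a single braid move
-- a(a+1)a ↔ (a+1)a(a+1) on three adjacent letters.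
braidHere : ℕ → List ℕ → List (List ℕ)
braidHere a (b ∷ c ∷ xs) =
  if ⌊ a ≟ c ⌋ ∧ (⌊ b ≟ suc a ⌋ ∨ ⌊ a ≟ suc b ⌋)
  then [ b ∷ a ∷ b ∷ xs ] else []
braidHere a _ = []

braidNbrs : List ℕ → List (List ℕ)
braidNbrs []       = []
braidNbrs (a ∷ xs) = braidHere a xs ++ map (a ∷_) (braidNbrs xs)

BraidAdj : List ℕ → List ℕ → Set
BraidAdj u v = v ∈ braidNbrs u

braidAdj? : (u v : List ℕ) → Dec (BraidAdj u v)
braidAdj? u v = v ∈? braidNbrs u

Vtau : ℕ → List ℕ → ℕ → List (List ℕ)
Vtau n τ i = map (_∷ʳ i) (R n τ)

-- Number of braid edges of G(σ) with exactly one endpoint in G(τ)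
-- (counted as pairs (u,v), u ∈ V(τ), v ∈ 𝓡(σ) ∖ V(τ), u –braid– v).
outBraid : ℕ → List ℕ → ℕ → List ℕ → ℕ
outBraid n τ i σ =
  length (filter (λ { (u , v) → braidAdj? u v ×-dec ¬? (v ∈? Vtau n τ i) })
                 (cartesianProduct (Vtau n τ i) (R n σ)))

-- A braid move keeping the last letter i
-- stays inside G(τ), because a reduced word of σ ending in i is t′·i with t′ ∈ 𝓡(τ).
-- So a braid edge leaving G(τ) rewrites the last three letters: it joins t·i·b·i to
-- t·b·i·b with |b − i| = 1, where b, the last letter of a reduced word of σ, is a
-- descent of σ, and t ∈ 𝓡(ρ_b) for ρ_b = σ sᵢ s_b sᵢ.  Conversely, if i and b are
-- both descents then σ decreases on the three positions moved by sᵢ s_b sᵢ, so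
-- ℓ(ρ_b) = ℓ(σ) − 3 and every t ∈ 𝓡(ρ_b) gives such an edge.  The leaving edges are
-- thus in bijection with the disjoint union of the 𝓡(ρ_b) over descents b = i ± 1.
module Submission where

open import Defs
open import Data.Nat using (ℕ; zero; suc; _+_; _∸_; _≤_; _<_; _≤?_; _<?_; _≟_; _<ᵇ_; z≤n; s≤s; s≤s⁻¹)
open import Data.Nat.Properties
open import Data.Nat.ListAction using (sum)
open import Data.Nat.Tactic.RingSolver using (solve-∀)
open import Data.List using (List; []; _∷_; map; length; filter; applyUpTo; foldl; concatMap; cartesianProduct; _∷ʳ_)
open import Data.List.Properties using (length-++; length-map; length-applyUpTo; foldl-∷ʳ; filter-none; filter-accept; filter-reject; ∷ʳ-injectiveˡ; ∷ʳ-injectiveʳ; ≡-dec)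
open import Data.List.Relation.Unary.All as All using (All; []; _∷_)
open import Data.List.Relation.Unary.All.Properties using (applyUpTo⁺₁; ∷ʳ⁺; ∷ʳ⁻) renaming (map⁺ to All-map⁺)
open import Data.List.Relation.Unary.AllPairs as AllPairs using ([]; _∷_)
import Data.List.Relation.Unary.AllPairs.Properties as AllPairsₚ
open import Data.List.Relation.Unary.Any using (here; there)
open import Data.List.Relation.Unary.Unique.Propositional using (Unique)
import Data.List.Relation.Unary.Unique.Propositional.Properties as Unique
open import Data.List.Relation.Binary.Disjoint.Propositional using (Disjoint)
open import Data.List.Relation.Binary.Permutation.Propositional.Properties using (↭-length)
open import Data.List.Relation.Binary.BagAndSetEquality using (∼bag⇒↭)
open import Data.List.Membership.Propositional using (_∈_; _∉_)
open import Data.List.Membership.Propositional.Properties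
open import Data.List.Membership.Propositional.Properties.WithK using (unique∧set⇒bag)
open import Data.List.Membership.DecPropositional (≡-dec _≟_) using (_∈?_)
open import Data.Bool using (true; false; if_then_else_)
open import Data.Product using (_×_; _,_; proj₁; proj₂; ∃; ∃₂)
open import Data.Sum using (_⊎_; inj₁; inj₂)
open import Data.Empty using (⊥-elim)
open import Function using (_∘_; id)
open import Function.Bundles using (Equivalence; _⇔_; mk⇔)
open import Relation.Nullary using (¬_; Dec; yes; no; does)
open import Relation.Unary using (Decidable)
open import Relation.Nullary.Decidable using (dec-true; dec-false; _×-dec_)
open import Relation.Binary.PropositionalEquality

ltBit : ℕ → ℕ → ℕ
ltBit x y = if does (x <? y) then 1 else 0

ltBit-< : ∀ {x y} → x < y → ltBit x y ≡ 1
ltBit-< {x} {y} x<y rewrite dec-true (x <? y) x<y = refl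

ltBit-≮ : ∀ {x y} → ¬ x < y → ltBit x y ≡ 0
ltBit-≮ {x} {y} x≮y rewrite dec-false (x <? y) x≮y = refl

ltBit≤1 : ∀ x y → ltBit x y ≤ 1
ltBit≤1 x y with does (x <? y)
... | true  = ≤-refl
... | false = z≤n

countBelow : ℕ → List ℕ → ℕ
countBelow z xs = length (filter (λ y → y <? z) xs)

countBelow-∷ : ∀ z x xs → countBelow z (x ∷ xs) ≡ ltBit x z + countBelow z xs
countBelow-∷ z x xs with x <ᵇ z
... | true  = refl
... | false = refl

swapAt-length : ∀ k xs → length (swapAt k xs) ≡ length xs
swapAt-length zero          xs           = refl
swapAt-length (suc zero)    []           = refl
swapAt-length (suc zero)    (x ∷ [])     = refl
swapAt-length (suc zero)    (x ∷ y ∷ xs) = refl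
swapAt-length (suc (suc k)) []           = refl
swapAt-length (suc (suc k)) (x ∷ xs)     = cong suc (swapAt-length (suc k) xs)

swapAt-involutive : ∀ k xs → swapAt k (swapAt k xs) ≡ xs
swapAt-involutive zero          xs           = refl
swapAt-involutive (suc zero)    []           = refl
swapAt-involutive (suc zero)    (x ∷ [])     = refl
swapAt-involutive (suc zero)    (x ∷ y ∷ xs) = refl
swapAt-involutive (suc (suc k)) []           = refl
swapAt-involutive (suc (suc k)) (x ∷ xs)     = cong (x ∷_) (swapAt-involutive (suc k) xs)

swapAt-beyond : ∀ k xs → length xs ≤ suc k → swapAt (suc k) xs ≡ xs
swapAt-beyond zero    []           _       = refl
swapAt-beyond zero    (x ∷ [])     _       = refl
swapAt-beyond zero    (x ∷ y ∷ xs) (s≤s ())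
swapAt-beyond (suc k) []           _       = refl
swapAt-beyond (suc k) (x ∷ xs)     (s≤s h) = cong (x ∷_) (swapAt-beyond k xs h)

countBelow-swapAt : ∀ z k xs → countBelow z (swapAt k xs) ≡ countBelow z xs
countBelow-swapAt z zero          xs           = refl
countBelow-swapAt z (suc zero)    []           = refl
countBelow-swapAt z (suc zero)    (x ∷ [])     = refl
countBelow-swapAt z (suc zero)    (x ∷ y ∷ xs) = begin
  countBelow z (y ∷ x ∷ xs)                   ≡⟨ countBelow-∷ z y (x ∷ xs) ⟩
  ltBit y z + countBelow z (x ∷ xs)           ≡⟨ cong (ltBit y z +_) (countBelow-∷ z x xs) ⟩
  ltBit y z + (ltBit x z + countBelow z xs)   ≡⟨ +-comm-middle (ltBit y z) (ltBit x z) (countBelow z xs) ⟩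
  ltBit x z + (ltBit y z + countBelow z xs)   ≡⟨ cong (ltBit x z +_) (countBelow-∷ z y xs) ⟨
  ltBit x z + countBelow z (y ∷ xs)           ≡⟨ countBelow-∷ z x (y ∷ xs) ⟨
  countBelow z (x ∷ y ∷ xs)                   ∎
  where
  open ≡-Reasoning
  +-comm-middle : ∀ a b c → a + (b + c) ≡ b + (a + c)
  +-comm-middle = solve-∀
countBelow-swapAt z (suc (suc k)) []       = refl
countBelow-swapAt z (suc (suc k)) (x ∷ xs) = begin
  countBelow z (x ∷ swapAt (suc k) xs)         ≡⟨ countBelow-∷ z x (swapAt (suc k) xs) ⟩
  ltBit x z + countBelow z (swapAt (suc k) xs) ≡⟨ cong (ltBit x z +_) (countBelow-swapAt z (suc k) xs) ⟩
  ltBit x z + countBelow z xs                  ≡⟨ countBelow-∷ z x xs ⟨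
  countBelow z (x ∷ xs)                        ∎
  where open ≡-Reasoning

-- Entries are 0-indexed here: swapAt (suc k) exchanges nth xs k and nth xs (suc k).
inv-swapAt : ∀ k xs → suc k < length xs →
  inv (swapAt (suc k) xs) + ltBit (nth xs (suc k)) (nth xs k) ≡ inv xs + ltBit (nth xs k) (nth xs (suc k))
inv-swapAt zero (x ∷ []) (s≤s ())
inv-swapAt zero (x ∷ y ∷ xs) _
  rewrite countBelow-∷ y x xs | countBelow-∷ x y xs =
    rearrange (ltBit x y) (ltBit y x) (countBelow y xs) (countBelow x xs) (inv xs)
  where
  rearrange : ∀ a b c d e → a + c + (d + e) + b ≡ b + d + (c + e) + a
  rearrange = solve-∀
inv-swapAt (suc k) (z ∷ xs) (s≤s h)
  rewrite countBelow-swapAt z (suc k) xs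
        | +-assoc (countBelow z xs) (inv (swapAt (suc k) xs)) (ltBit (nth xs (suc k)) (nth xs k))
        | +-assoc (countBelow z xs) (inv xs) (ltBit (nth xs k) (nth xs (suc k)))
  = cong (countBelow z xs +_) (inv-swapAt k xs h)

inv-swapAt-descent : ∀ k xs → suc k < length xs → nth xs (suc k) < nth xs k →
  suc (inv (swapAt (suc k) xs)) ≡ inv xs
inv-swapAt-descent k xs h d with inv-swapAt k xs h
... | e rewrite ltBit-< d | ltBit-≮ (<⇒≯ d) = trans (+-comm 1 _) (trans e (+-identityʳ _))

inv-swapAt-ascent : ∀ k xs → suc k < length xs → ¬ nth xs (suc k) < nth xs k →
  inv xs ≤ inv (swapAt (suc k) xs)
inv-swapAt-ascent k xs h d with inv-swapAt k xs h
... | e rewrite ltBit-≮ d = ≤-trans (m≤m+n (inv xs) _) (≤-reflexive (trans (sym e) (+-identityʳ _)))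

inv-swapAt-≤ : ∀ k xs → inv (swapAt k xs) ≤ suc (inv xs)
inv-swapAt-≤ zero    xs = n≤1+n _
inv-swapAt-≤ (suc k) xs with suc k <? length xs
... | no h rewrite swapAt-beyond k xs (≮⇒≥ h) = n≤1+n _
... | yes h = begin
  inv (swapAt (suc k) xs)                                    ≤⟨ m≤m+n _ _ ⟩
  inv (swapAt (suc k) xs) + ltBit (nth xs (suc k)) (nth xs k) ≡⟨ inv-swapAt k xs h ⟩
  inv xs + ltBit (nth xs k) (nth xs (suc k))                 ≤⟨ +-monoʳ-≤ (inv xs) (ltBit≤1 (nth xs k) (nth xs (suc k))) ⟩
  inv xs + 1                                                 ≡⟨ +-comm (inv xs) 1 ⟩
  suc (inv xs)                                               ∎
  where open ≤-Reasoning

nth-swapAt-left : ∀ k xs → suc k < length xs → nth (swapAt (suc k) xs) k ≡ nth xs (suc k)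
nth-swapAt-left zero    (x ∷ [])     (s≤s ())
nth-swapAt-left zero    (x ∷ y ∷ xs) _       = refl
nth-swapAt-left (suc k) (x ∷ xs)     (s≤s h) = nth-swapAt-left k xs h

nth-swapAt-right : ∀ k xs → suc k < length xs → nth (swapAt (suc k) xs) (suc k) ≡ nth xs k
nth-swapAt-right zero    (x ∷ [])     (s≤s ())
nth-swapAt-right zero    (x ∷ y ∷ xs) _       = refl
nth-swapAt-right (suc k) (x ∷ xs)     (s≤s h) = nth-swapAt-right k xs h

nth-swapAt-after : ∀ k xs → nth (swapAt (suc k) xs) (suc (suc k)) ≡ nth xs (suc (suc k))
nth-swapAt-after zero    []           = refl
nth-swapAt-after zero    (x ∷ [])     = refl
nth-swapAt-after zero    (x ∷ y ∷ xs) = refl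
nth-swapAt-after (suc k) []           = refl
nth-swapAt-after (suc k) (x ∷ xs)     = nth-swapAt-after k xs

nth-swapAt-before : ∀ k xs → nth (swapAt (suc (suc k)) xs) k ≡ nth xs k
nth-swapAt-before zero    []       = refl
nth-swapAt-before zero    (x ∷ xs) = refl
nth-swapAt-before (suc k) []       = refl
nth-swapAt-before (suc k) (x ∷ xs) = nth-swapAt-before k xs

swapAt-braid : ∀ k xs → suc (suc k) < length xs →
  swapAt (suc k) (swapAt (suc (suc k)) (swapAt (suc k) xs)) ≡ swapAt (suc (suc k)) (swapAt (suc k) (swapAt (suc (suc k)) xs))
swapAt-braid zero    (x ∷ [])         (s≤s ())
swapAt-braid zero    (x ∷ y ∷ [])     (s≤s (s≤s ()))
swapAt-braid zero    (x ∷ y ∷ z ∷ xs) _       = refl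
swapAt-braid (suc k) (x ∷ xs)         (s≤s h) = cong (x ∷_) (swapAt-braid k xs h)

inv-swapAt-braid-decreasing : ∀ k xs → suc (suc k) < length xs →
  nth xs (suc k) < nth xs k → nth xs (suc (suc k)) < nth xs (suc k) →
  3 + inv (swapAt (suc k) (swapAt (suc (suc k)) (swapAt (suc k) xs))) ≡ inv xs
inv-swapAt-braid-decreasing k xs h d₁ d₂ = begin
  3 + inv (swapAt (suc k) ys₂) ≡⟨ cong (suc ∘ suc) (inv-swapAt-descent k ys₂ h₂ d₂′) ⟩
  2 + inv ys₂                  ≡⟨ cong suc (inv-swapAt-descent (suc k) ys₁ h₁′ d₁′) ⟩
  1 + inv ys₁                  ≡⟨ inv-swapAt-descent k xs h₁ d₁ ⟩
  inv xs                       ∎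
  where
  open ≡-Reasoning
  ys₁ = swapAt (suc k) xs
  ys₂ = swapAt (suc (suc k)) ys₁
  h₁ : suc k < length xs
  h₁ = <-trans (n<1+n _) h
  h₁′ : suc (suc k) < length ys₁
  h₁′ rewrite swapAt-length (suc k) xs = h
  h₂ : suc k < length ys₂
  h₂ rewrite swapAt-length (suc (suc k)) ys₁ | swapAt-length (suc k) xs = h₁
  d₁′ : nth ys₁ (suc (suc k)) < nth ys₁ (suc k)
  d₁′ rewrite nth-swapAt-after k xs | nth-swapAt-right k xs h₁ = <-trans d₂ d₁
  d₂′ : nth ys₂ (suc k) < nth ys₂ k
  d₂′ rewrite nth-swapAt-left (suc k) ys₁ h₁′ | nth-swapAt-before k ys₁ | nth-swapAt-after k xs | nth-swapAt-left k xs h₁ = d₂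

length-∷ʳ : ∀ (w : List ℕ) a → length (w ∷ʳ a) ≡ suc (length w)
length-∷ʳ w a = trans (length-++ w) (+-comm (length w) 1)

length-∷ʳ² : ∀ (w : List ℕ) a b → length (w ∷ʳ a ∷ʳ b) ≡ 2 + length w
length-∷ʳ² w a b = trans (length-∷ʳ (w ∷ʳ a) b) (cong suc (length-∷ʳ w a))

length-∷ʳ³ : ∀ (w : List ℕ) a b c → length (w ∷ʳ a ∷ʳ b ∷ʳ c) ≡ 3 + length w
length-∷ʳ³ w a b c = trans (length-∷ʳ (w ∷ʳ a ∷ʳ b) c) (cong suc (length-∷ʳ² w a b))

eval-∷ʳ : ∀ n w a → eval n (w ∷ʳ a) ≡ rmul (eval n w) a
eval-∷ʳ n w a = foldl-∷ʳ rmul (iota n) a w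

eval-∷ʳ² : ∀ n w a b → eval n (w ∷ʳ a ∷ʳ b) ≡ rmul (rmul (eval n w) a) b
eval-∷ʳ² n w a b = trans (eval-∷ʳ n (w ∷ʳ a) b) (cong (λ π → rmul π b) (eval-∷ʳ n w a))

eval-∷ʳ³ : ∀ n w a b c → eval n (w ∷ʳ a ∷ʳ b ∷ʳ c) ≡ rmul (rmul (rmul (eval n w) a) b) c
eval-∷ʳ³ n w a b c = trans (eval-∷ʳ n (w ∷ʳ a ∷ʳ b) c) (cong (λ π → rmul π c) (eval-∷ʳ² n w a b))

foldl-rmul-length : ∀ π w → length (foldl rmul π w) ≡ length π
foldl-rmul-length π []      = refl
foldl-rmul-length π (a ∷ w) = trans (foldl-rmul-length (swapAt a π) w) (swapAt-length a π)

eval-length : ∀ n w → length (eval n w) ≡ n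
eval-length n w = trans (foldl-rmul-length (iota n) w) (length-applyUpTo suc n)

inv-foldl-rmul-≤ : ∀ π w → inv (foldl rmul π w) ≤ length w + inv π
inv-foldl-rmul-≤ π []      = ≤-refl
inv-foldl-rmul-≤ π (a ∷ w) = begin
  inv (foldl rmul (swapAt a π) w) ≤⟨ inv-foldl-rmul-≤ (swapAt a π) w ⟩
  length w + inv (swapAt a π)     ≤⟨ +-monoʳ-≤ (length w) (inv-swapAt-≤ a π) ⟩
  length w + suc (inv π)          ≡⟨ +-suc (length w) (inv π) ⟩
  suc (length w + inv π)          ∎
  where open ≤-Reasoning

inv-applyUpTo-monotone : ∀ (f : ℕ → ℕ) n → (∀ {x y} → x ≤ y → f x ≤ f y) → inv (applyUpTo f n) ≡ 0
inv-applyUpTo-monotone f zero    mono = refl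
inv-applyUpTo-monotone f (suc n) mono
  rewrite filter-none (λ y → y <? f zero) (applyUpTo⁺₁ (f ∘ suc) n (λ _ → ≤⇒≯ (mono z≤n)))
  = inv-applyUpTo-monotone (f ∘ suc) n (mono ∘ s≤s)

inv-eval-≤ : ∀ n w → inv (eval n w) ≤ length w
inv-eval-≤ n w = begin
  inv (eval n w)            ≤⟨ inv-foldl-rmul-≤ (iota n) w ⟩
  length w + inv (iota n)   ≡⟨ cong (length w +_) (inv-applyUpTo-monotone suc n s≤s) ⟩
  length w + 0              ≡⟨ +-identityʳ _ ⟩
  length w                  ∎
  where open ≤-Reasoning

∈-letters⁻ : ∀ {n a} → a ∈ letters n → 1 ≤ a × suc a ≤ n
∈-letters⁻ {suc n} a∈ with ∈-applyUpTo⁻ suc a∈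
... | k , k<n , refl = s≤s z≤n , s≤s k<n

∈-letters⁺ : ∀ {n a} → 1 ≤ a → suc a ≤ n → a ∈ letters n
∈-letters⁺ {suc n} {suc k} _ (s≤s k<n) = ∈-applyUpTo⁺ suc k<n

letters-unique : ∀ n → Unique (letters n)
letters-unique n = Unique.applyUpTo⁺₁ suc (n ∸ 1) (λ x<y _ → <⇒≢ x<y ∘ suc-injective)

∈-allWords⁻ : ∀ {n} l w → w ∈ allWords n l → All (_∈ letters n) w × length w ≡ l
∈-allWords⁻ zero w (here refl) = [] , refl
∈-allWords⁻ {n} (suc l) w w∈ with ∈-concat⁻′ (map (λ a → map (a ∷_) (allWords n l)) (letters n)) w∈
... | ws , w∈ws , ws∈ with ∈-map⁻ (λ a → map (a ∷_) (allWords n l)) ws∈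
... | a , a∈ , refl with ∈-map⁻ (a ∷_) w∈ws
... | w′ , w′∈ , refl with ∈-allWords⁻ l w′ w′∈
... | all , len = a∈ ∷ all , cong suc len

∈-allWords⁺ : ∀ {n} w → All (_∈ letters n) w → w ∈ allWords n (length w)
∈-allWords⁺ []      []         = here refl
∈-allWords⁺ {n} (a ∷ w) (a∈ ∷ all) =
  ∈-concat⁺′ (∈-map⁺ (a ∷_) (∈-allWords⁺ w all)) (∈-map⁺ (λ b → map (b ∷_) (allWords n (length w))) a∈)

allWords-unique : ∀ n l → Unique (allWords n l)
allWords-unique n zero    = [] ∷ []
allWords-unique n (suc l) =
  Unique.concat⁺ (All-map⁺ (All.tabulate (λ _ → Unique.map⁺ ∷-injectiveʳ (allWords-unique n l))))
                 (AllPairsₚ.map⁺ (AllPairs.map disjoint (letters-unique n)))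
  where
  ∷-injectiveʳ : ∀ {a} {w w′ : List ℕ} → a ∷ w ≡ a ∷ w′ → w ≡ w′
  ∷-injectiveʳ refl = refl
  disjoint : ∀ {a b} → a ≢ b → Disjoint (map (a ∷_) (allWords n l)) (map (b ∷_) (allWords n l))
  disjoint a≢b (v∈a , v∈b) with ∈-map⁻ _ v∈a | ∈-map⁻ _ v∈b
  ... | _ , _ , refl | _ , _ , refl = a≢b refl

∈-R⁻ : ∀ {n π w} → w ∈ R n π → All (_∈ letters n) w × length w ≡ inv π × eval n w ≡ π
∈-R⁻ {n} {π} {w} w∈ with ∈-filter⁻ (λ w → ≡-dec _≟_ (eval n w) π) w∈
... | w∈words , ev with ∈-allWords⁻ (inv π) w w∈words
... | all , len = all , len , ev

∈-R⁺ : ∀ {n π w} → All (_∈ letters n) w → length w ≡ inv π → eval n w ≡ π → w ∈ R n π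
∈-R⁺ {n} {π} {w} all len ev =
  ∈-filter⁺ (λ w → ≡-dec _≟_ (eval n w) π) (subst (λ l → w ∈ allWords n l) len (∈-allWords⁺ w all)) ev

R-unique : ∀ n π → Unique (R n π)
R-unique n π = Unique.filter⁺ (λ w → ≡-dec _≟_ (eval n w) π) (allWords-unique n (inv π))

R-∷ʳ⁻ : ∀ {n π w a} → (w ∷ʳ a) ∈ R n π → w ∈ R n (rmul π a)
R-∷ʳ⁻ {n} {π} {w} {a} w∈ with ∈-R⁻ {n} {π} w∈
... | all , len , ev = ∈-R⁺ (proj₁ (∷ʳ⁻ all)) (≤-antisym lower upper) ev′
  where
  ev′ : eval n w ≡ rmul π a
  ev′ = begin
    eval n w                       ≡⟨ swapAt-involutive a (eval n w) ⟨
    swapAt a (swapAt a (eval n w)) ≡⟨ cong (swapAt a) (eval-∷ʳ n w a) ⟨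
    swapAt a (eval n (w ∷ʳ a))     ≡⟨ cong (swapAt a) ev ⟩
    rmul π a                       ∎
    where open ≡-Reasoning
  lower : length w ≤ inv (rmul π a)
  lower = s≤s⁻¹ (begin
    suc (length w)                ≡⟨ trans (sym (length-∷ʳ w a)) len ⟩
    inv π                         ≡⟨ cong inv (swapAt-involutive a π) ⟨
    inv (swapAt a (swapAt a π))   ≤⟨ inv-swapAt-≤ a (swapAt a π) ⟩
    suc (inv (rmul π a))          ∎)
    where open ≤-Reasoning
  upper : inv (rmul π a) ≤ length w
  upper = subst (λ σ → inv σ ≤ length w) ev′ (inv-eval-≤ n w)

R-last-descent : ∀ {n π w a} → (w ∷ʳ a) ∈ R n π → InDes π a
R-last-descent {n} {π} {w} {a} w∈ with ∈-R⁻ {n} {π} w∈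
... | all , len , ev with ∈-letters⁻ {n} (proj₂ (∷ʳ⁻ all))
... | 1≤a@(s≤s {n = k} z≤n) , a<n = 1≤a , a<∣π∣ , descent
  where
  a<∣π∣ : suc a ≤ length π
  a<∣π∣ = subst (suc a ≤_) (trans (sym (eval-length n (w ∷ʳ a))) (cong length ev)) a<n
  descent : nth π a < nth π k
  descent with nth π a <? nth π k
  ... | yes d = d
  ... | no ¬d = ⊥-elim (<-irrefl refl (begin-strict
    length w             <⟨ n<1+n _ ⟩
    suc (length w)       ≡⟨ trans (sym (length-∷ʳ w a)) len ⟩
    inv π                ≤⟨ inv-swapAt-ascent k π a<∣π∣ ¬d ⟩
    inv (rmul π a)       ≡⟨ proj₁ (proj₂ (∈-R⁻ {n} {rmul π a} (R-∷ʳ⁻ {n} {π} w∈))) ⟨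
    length w             ∎))
    where open ≤-Reasoning

Adjacent : ℕ → ℕ → Set
Adjacent a b = b ≡ suc a ⊎ a ≡ suc b

braidHere⁻ : ∀ {v} a b c xs → v ∈ braidHere a (b ∷ c ∷ xs) → a ≡ c × Adjacent a b × v ≡ b ∷ a ∷ b ∷ xs
braidHere⁻ a b c xs v∈ with a ≟ c | b ≟ suc a | a ≟ suc b
braidHere⁻ a b c xs (here v≡) | yes a≡c | yes b≡ | _     = a≡c , inj₁ b≡ , v≡
braidHere⁻ a b c xs (here v≡) | yes a≡c | no _   | yes a≡ = a≡c , inj₂ a≡ , v≡
braidHere⁻ a b c xs ()        | yes _   | no _   | no _
braidHere⁻ a b c xs ()        | no _    | _      | _

braidHere⁺ : ∀ a b xs → Adjacent a b → (b ∷ a ∷ b ∷ xs) ∈ braidHere a (b ∷ a ∷ xs)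
braidHere⁺ a b xs adj with a ≟ a | b ≟ suc a | a ≟ suc b
... | no a≢a | _     | _     = ⊥-elim (a≢a refl)
... | yes _  | yes _ | _     = here refl
... | yes _  | no _  | yes _ = here refl
braidHere⁺ a b xs (inj₁ b≡) | yes _ | no b≢ | no _  = ⊥-elim (b≢ b≡)
braidHere⁺ a b xs (inj₂ a≡) | yes _ | no _  | no a≢ = ⊥-elim (a≢ a≡)

braidNbrs-∷ʳ⁺ : ∀ t a b → Adjacent a b → BraidAdj (t ∷ʳ a ∷ʳ b ∷ʳ a) (t ∷ʳ b ∷ʳ a ∷ʳ b)
braidNbrs-∷ʳ⁺ []      a b adj = ∈-++⁺ˡ (braidHere⁺ a b [] adj)
braidNbrs-∷ʳ⁺ (x ∷ t) a b adj = ∈-++⁺ʳ _ (∈-map⁺ (x ∷_) (braidNbrs-∷ʳ⁺ t a b adj))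

braidNbrs-∷ʳ⁻ : ∀ t a v → BraidAdj (t ∷ʳ a) v →
  (∃ λ t′ → v ≡ t′ ∷ʳ a) ⊎
  (∃₂ λ t′ b → t ≡ t′ ∷ʳ a ∷ʳ b × Adjacent a b × v ≡ t′ ∷ʳ b ∷ʳ a ∷ʳ b)
braidNbrs-∷ʳ⁻ []      a v ()
braidNbrs-∷ʳ⁻ (x ∷ t) a v v∈ with ∈-++⁻ (braidHere x (t ∷ʳ a)) v∈
braidNbrs-∷ʳ⁻ (x ∷ [])         a v _ | inj₁ ()
braidNbrs-∷ʳ⁻ (x ∷ y ∷ [])     a v _ | inj₁ v∈ with braidHere⁻ x y a [] v∈
... | refl , adj , refl = inj₂ ([] , y , refl , adj , refl)
braidNbrs-∷ʳ⁻ (x ∷ y ∷ z ∷ t) a v _ | inj₁ v∈ with braidHere⁻ x y z (t ∷ʳ a) v∈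
... | refl , _ , refl = inj₁ (y ∷ x ∷ y ∷ t , refl)
braidNbrs-∷ʳ⁻ (x ∷ t) a v _ | inj₂ v∈ with ∈-map⁻ (x ∷_) v∈
... | v′ , v′∈ , refl with braidNbrs-∷ʳ⁻ t a v′ v′∈
... | inj₁ (t′ , refl)                    = inj₁ (x ∷ t′ , refl)
... | inj₂ (t′ , b , refl , adj , refl)   = inj₂ (x ∷ t′ , b , refl , adj , refl)

InDes? : ∀ π b → Dec (InDes π b)
InDes? π b = (1 ≤? b) ×-dec (suc b ≤? length π) ×-dec (at π (suc b) <? at π b)

unique-length : ∀ {A : Set} {xs ys : List A} → Unique xs → Unique ys → (∀ {x} → x ∈ xs ⇔ x ∈ ys) →
  length xs ≡ length ys
unique-length xs! ys! xs⇔ys = ↭-length (∼bag⇒↭ (unique∧set⇒bag xs! ys! xs⇔ys))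

module ExitEdges (n : ℕ) (σ τ : List ℕ) (j : ℕ) (∣σ∣≡n : length σ ≡ n)
                 (τsᵢ≡σ : rmul τ (suc j) ≡ σ) (ℓσ≡1+ℓτ : inv σ ≡ suc (inv τ)) where

  i : ℕ
  i = suc j

  neighbours : List ℕ
  neighbours = suc i ∷ j ∷ []

  ρ : ℕ → List ℕ
  ρ b = rmul (rmul (rmul σ i) b) i

  V : List (List ℕ)
  V = Vtau n τ i

  ExitEdge : List ℕ × List ℕ → Set
  ExitEdge (u , v) = u ∈ V × v ∈ R n σ × BraidAdj u v × v ∉ V

  edge : ℕ → List ℕ → List ℕ × List ℕ
  edge b t = t ∷ʳ i ∷ʳ b ∷ʳ i , t ∷ʳ b ∷ʳ i ∷ʳ b

  edges : ℕ → List (List ℕ × List ℕ)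
  edges b = map (edge b) (R n (ρ b))

  σsᵢ≡τ : rmul σ i ≡ τ
  σsᵢ≡τ = trans (cong (swapAt i) (sym τsᵢ≡σ)) (swapAt-involutive i τ)

  neighbour⇒adjacent : ∀ {b} → b ∈ neighbours → Adjacent i b
  neighbour⇒adjacent (here refl)         = inj₁ refl
  neighbour⇒adjacent (there (here refl)) = inj₂ refl

  adjacent⇒neighbour : ∀ {b} → Adjacent i b → b ∈ neighbours
  adjacent⇒neighbour (inj₁ refl) = here refl
  adjacent⇒neighbour (inj₂ refl) = there (here refl)

  neighbours-unique : Unique neighbours
  neighbours-unique = (>⇒≢ (m<n⇒m<1+n (n<1+n j)) ∷ []) ∷ [] ∷ []

  descent⇒letter : ∀ {b} → InDes σ b → b ∈ letters n
  descent⇒letter (1≤b , b<∣σ∣ , _) = ∈-letters⁺ 1≤b (subst (suc _ ≤_) ∣σ∣≡n b<∣σ∣)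

  ρ-braid : ∀ {b} → b ∈ neighbours → InDes σ i → InDes σ b → ρ b ≡ rmul (rmul (rmul σ b) i) b
  ρ-braid (here refl)         _                (_ , b<∣σ∣ , _)     = swapAt-braid j σ b<∣σ∣
  ρ-braid (there (here refl)) (_ , i<∣σ∣ , _) (s≤s {n = k} z≤n , _) = sym (swapAt-braid k σ i<∣σ∣)

  inv-ρ : ∀ {b} → b ∈ neighbours → InDes σ i → InDes σ b → 3 + inv (ρ b) ≡ inv σ
  inv-ρ (here refl) (_ , _ , dᵢ) (_ , b<∣σ∣ , d_b) = inv-swapAt-braid-decreasing j σ b<∣σ∣ dᵢ d_b
  inv-ρ b∈@(there (here refl)) Dᵢ@(_ , i<∣σ∣ , dᵢ) D_b@(s≤s {n = k} z≤n , _ , d_b) =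
    trans (cong (λ π → 3 + inv π) (ρ-braid b∈ Dᵢ D_b)) (inv-swapAt-braid-decreasing k σ i<∣σ∣ d_b dᵢ)

  exit⇒edge : ∀ {u v} → ExitEdge (u , v) → ∃ λ b → b ∈ neighbours × InDes σ b × (u , v) ∈ edges b
  exit⇒edge (u∈ , v∈ , adj , v∉) with ∈-map⁻ (_∷ʳ i) u∈
  ... | t , t∈ , refl with braidNbrs-∷ʳ⁻ t i _ adj
  ... | inj₁ (t′ , refl) = ⊥-elim (v∉ (∈-map⁺ (_∷ʳ i) (subst (λ π → t′ ∈ R n π) σsᵢ≡τ (R-∷ʳ⁻ {n} {σ} v∈))))
  ... | inj₂ (t′ , b , refl , adj′ , refl) =
    b , adjacent⇒neighbour adj′ , R-last-descent {n} {σ} v∈ , ∈-map⁺ (edge b) t′∈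
    where
    t′∈ : t′ ∈ R n (ρ b)
    t′∈ = subst (λ π → t′ ∈ R n (rmul (rmul π b) i)) (sym σsᵢ≡τ) (R-∷ʳ⁻ {n} (R-∷ʳ⁻ {n} {τ} t∈))

  neighbour≢i : ∀ {b} → b ∈ neighbours → b ≢ i
  neighbour≢i (here refl)         = 1+n≢n
  neighbour≢i (there (here refl)) = ≢-sym 1+n≢n

  edge-source-reduced : ∀ {b t} → b ∈ neighbours → InDes σ i → InDes σ b → t ∈ R n (ρ b) →
    t ∷ʳ i ∷ʳ b ∈ R n τ
  edge-source-reduced {b} {t} b∈ Dᵢ D_b t∈ with ∈-R⁻ {n} {ρ b} t∈
  ... | letters-t , ∣t∣≡ℓρ , ev =
    ∈-R⁺ (∷ʳ⁺ (∷ʳ⁺ letters-t (descent⇒letter Dᵢ)) (descent⇒letter D_b))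
      (trans (length-∷ʳ² t i b) (suc-injective (trans (cong (3 +_) ∣t∣≡ℓρ) (trans (inv-ρ b∈ Dᵢ D_b) ℓσ≡1+ℓτ))))
      (begin
        eval n (t ∷ʳ i ∷ʳ b)            ≡⟨ eval-∷ʳ² n t i b ⟩
        rmul (rmul (eval n t) i) b      ≡⟨ cong (λ π → rmul (rmul π i) b) ev ⟩
        rmul (rmul (ρ b) i) b           ≡⟨ cong (swapAt b) (swapAt-involutive i _) ⟩
        rmul (rmul (rmul σ i) b) b      ≡⟨ swapAt-involutive b _ ⟩
        rmul σ i                        ≡⟨ σsᵢ≡τ ⟩
        τ                               ∎)
    where open ≡-Reasoning

  edge-target-reduced : ∀ {b t} → b ∈ neighbours → InDes σ i → InDes σ b → t ∈ R n (ρ b) →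
    t ∷ʳ b ∷ʳ i ∷ʳ b ∈ R n σ
  edge-target-reduced {b} {t} b∈ Dᵢ D_b t∈ with ∈-R⁻ {n} {ρ b} t∈
  ... | letters-t , ∣t∣≡ℓρ , ev =
    ∈-R⁺ (∷ʳ⁺ (∷ʳ⁺ (∷ʳ⁺ letters-t (descent⇒letter D_b)) (descent⇒letter Dᵢ)) (descent⇒letter D_b))
      (trans (length-∷ʳ³ t b i b) (trans (cong (3 +_) ∣t∣≡ℓρ) (inv-ρ b∈ Dᵢ D_b)))
      (begin
        eval n (t ∷ʳ b ∷ʳ i ∷ʳ b)                               ≡⟨ eval-∷ʳ³ n t b i b ⟩
        rmul (rmul (rmul (eval n t) b) i) b                     ≡⟨ cong (λ π → rmul (rmul (rmul π b) i) b) (trans ev (ρ-braid b∈ Dᵢ D_b)) ⟩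
        rmul (rmul (rmul (rmul (rmul (rmul σ b) i) b) b) i) b   ≡⟨ cong (λ π → rmul (rmul π i) b) (swapAt-involutive b _) ⟩
        rmul (rmul (rmul (rmul σ b) i) i) b                     ≡⟨ cong (swapAt b) (swapAt-involutive i _) ⟩
        rmul (rmul σ b) b                                       ≡⟨ swapAt-involutive b σ ⟩
        σ                                                       ∎)
    where open ≡-Reasoning

  edge⇒exit : ∀ {b e} → b ∈ neighbours → InDes σ i → InDes σ b → e ∈ edges b → ExitEdge e
  edge⇒exit {b} b∈ Dᵢ D_b e∈ with ∈-map⁻ (edge b) e∈
  ... | t , t∈ , refl =
    ∈-map⁺ (_∷ʳ i) (edge-source-reduced b∈ Dᵢ D_b t∈) ,
    edge-target-reduced b∈ Dᵢ D_b t∈ ,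
    braidNbrs-∷ʳ⁺ t i b (neighbour⇒adjacent b∈) ,
    target∉V
    where
    target∉V : t ∷ʳ b ∷ʳ i ∷ʳ b ∉ V
    target∉V v∈V with ∈-map⁻ (_∷ʳ i) v∈V
    ... | s , _ , v≡ = neighbour≢i b∈ (∷ʳ-injectiveʳ (t ∷ʳ b ∷ʳ i) s v≡)

  edges-unique : ∀ b → Unique (edges b)
  edges-unique b = Unique.map⁺ edge-injective (R-unique n (ρ b))
    where
    edge-injective : ∀ {t t′} → edge b t ≡ edge b t′ → t ≡ t′
    edge-injective {t} {t′} e =
      ∷ʳ-injectiveˡ t t′ (∷ʳ-injectiveˡ (t ∷ʳ i) (t′ ∷ʳ i) (∷ʳ-injectiveˡ (t ∷ʳ i ∷ʳ b) (t′ ∷ʳ i ∷ʳ b) (cong proj₁ e)))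

  edges-disjoint : ∀ {b b′} → b ≢ b′ → Disjoint (edges b) (edges b′)
  edges-disjoint {b} {b′} b≢b′ (e∈ , e∈′) with ∈-map⁻ (edge b) e∈ | ∈-map⁻ (edge b′) e∈′
  ... | t , _ , refl | t′ , _ , e≡ = b≢b′ (∷ʳ-injectiveʳ (t ∷ʳ b ∷ʳ i) (t′ ∷ʳ b′ ∷ʳ i) (cong proj₂ e≡))

  length-concatMap-edges : ∀ bs → length (concatMap edges bs) ≡ sum (map (numR n ∘ ρ) bs)
  length-concatMap-edges []       = refl
  length-concatMap-edges (b ∷ bs) =
    trans (length-++ (edges b)) (cong₂ _+_ (length-map (edge b) (R n (ρ b))) (length-concatMap-edges bs))

  -- P is left abstract because outBraid filters by a pattern lambda, which only unification can name.
  exits-count : ∀ {P : List ℕ × List ℕ → Set} (P? : Decidable P) → (∀ {u v} → P (u , v) ⇔ (BraidAdj u v × v ∉ V)) → InDes σ i →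
    length (filter P? (cartesianProduct V (R n σ))) ≡ sum (map (numR n ∘ ρ) (filter (InDes? σ) neighbours))
  exits-count P? P⇔exit Dᵢ =
    trans (unique-length exits-unique edges-unique′ (mk⇔ to from)) (length-concatMap-edges descentNeighbours)
    where
    descentNeighbours = filter (InDes? σ) neighbours
    exits-unique : Unique (filter P? (cartesianProduct V (R n σ)))
    exits-unique = Unique.filter⁺ P? (Unique.cartesianProduct⁺
      (Unique.map⁺ (λ {t} {t′} → ∷ʳ-injectiveˡ t t′) (R-unique n τ)) (R-unique n σ))
    edges-unique′ : Unique (concatMap edges descentNeighbours)
    edges-unique′ = Unique.concat⁺ (All-map⁺ (All.tabulate (λ {b} _ → edges-unique b)))
      (AllPairsₚ.map⁺ (AllPairs.map edges-disjoint (Unique.filter⁺ (InDes? σ) neighbours-unique)))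
    to : ∀ {e} → e ∈ filter P? (cartesianProduct V (R n σ)) → e ∈ concatMap edges descentNeighbours
    to {u , v} e∈ with ∈-filter⁻ P? e∈
    ... | e∈V×R , Pe with ∈-cartesianProduct⁻ V (R n σ) e∈V×R
    ... | u∈ , v∈ with exit⇒edge (u∈ , v∈ , Equivalence.to P⇔exit Pe)
    ... | b , b∈ , D_b , e∈b = ∈-concat⁺′ e∈b (∈-map⁺ edges (∈-filter⁺ (InDes? σ) b∈ D_b))
    from : ∀ {e} → e ∈ concatMap edges descentNeighbours → e ∈ filter P? (cartesianProduct V (R n σ))
    from {u , v} e∈ with ∈-concat⁻′ (map edges descentNeighbours) e∈
    ... | es , e∈es , es∈ with ∈-map⁻ edges es∈
    ... | b , b∈DN , refl with ∈-filter⁻ (InDes? σ) b∈DN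
    ... | b∈ , D_b with edge⇒exit b∈ Dᵢ D_b e∈es
    ... | u∈ , v∈ , adj , v∉ = ∈-filter⁺ P? (∈-cartesianProduct⁺ u∈ v∈) (Equivalence.from P⇔exit (adj , v∉))

proposition4p8 : (n : ℕ) → 2 ≤ n → (σ τ : List ℕ) → IsPerm n σ → IsPerm n τ →
    (i : ℕ) → 1 ≤ i → i < n → rmul τ i ≡ σ → inv σ ≡ suc (inv τ) →
    ((InDes σ (i ∸ 1) → InDes σ i → InDes σ (suc i) →
        outBraid n τ i σ ≡ numR n (rmul (rmul (rmul σ i) (suc i)) i) + numR n (rmul (rmul (rmul σ i) (i ∸ 1)) i))
    × (InDes σ i → InDes σ (suc i) → ¬ InDes σ (i ∸ 1) →
        outBraid n τ i σ ≡ numR n (rmul (rmul (rmul σ i) (suc i)) i))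
    × (InDes σ (i ∸ 1) → InDes σ i → ¬ InDes σ (suc i) →
        outBraid n τ i σ ≡ numR n (rmul (rmul (rmul σ i) (i ∸ 1)) i))
    × (¬ InDes σ (i ∸ 1) → ¬ InDes σ (suc i) →
        (u v : List ℕ) → v ∈ R n σ → BraidAdj u v → u ∈ Vtau n τ i → v ∈ Vtau n τ i))
proposition4p8 n _ σ τ σ-perm _ (suc j) (s≤s z≤n) _ τsᵢ≡σ ℓσ≡1+ℓτ = both , upper-only , lower-only , neither
  where
  open ExitEdges n σ τ j (trans (↭-length σ-perm) (length-applyUpTo suc n)) τsᵢ≡σ ℓσ≡1+ℓτ
  count : InDes σ i → outBraid n τ i σ ≡ sum (map (numR n ∘ ρ) (filter (InDes? σ) neighbours))
  count = exits-count _ (mk⇔ id id)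
  both : InDes σ j → InDes σ i → InDes σ (suc i) → outBraid n τ i σ ≡ numR n (ρ (suc i)) + numR n (ρ j)
  both Dⱼ Dᵢ Dᵢ₊₁ rewrite count Dᵢ | filter-accept (InDes? σ) {xs = j ∷ []} Dᵢ₊₁ | filter-accept (InDes? σ) {xs = []} Dⱼ =
    cong (numR n (ρ (suc i)) +_) (+-identityʳ _)
  upper-only : InDes σ i → InDes σ (suc i) → ¬ InDes σ j → outBraid n τ i σ ≡ numR n (ρ (suc i))
  upper-only Dᵢ Dᵢ₊₁ ¬Dⱼ rewrite count Dᵢ | filter-accept (InDes? σ) {xs = j ∷ []} Dᵢ₊₁ | filter-reject (InDes? σ) {xs = []} ¬Dⱼ =
    +-identityʳ _
  lower-only : InDes σ j → InDes σ i → ¬ InDes σ (suc i) → outBraid n τ i σ ≡ numR n (ρ j)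
  lower-only Dⱼ Dᵢ ¬Dᵢ₊₁ rewrite count Dᵢ | filter-reject (InDes? σ) {xs = j ∷ []} ¬Dᵢ₊₁ | filter-accept (InDes? σ) {xs = []} Dⱼ =
    +-identityʳ _
  neither : ¬ InDes σ j → ¬ InDes σ (suc i) → ∀ u v → v ∈ R n σ → BraidAdj u v → u ∈ V → v ∈ V
  neither ¬Dⱼ ¬Dᵢ₊₁ u v v∈ adj u∈ with v ∈? V
  ... | yes v∈V = v∈V
  ... | no v∉V with exit⇒edge (u∈ , v∈ , adj , v∉V)
  ... | _ , here refl         , Dᵢ₊₁ , _ = ⊥-elim (¬Dᵢ₊₁ Dᵢ₊₁)
  ... | _ , there (here refl) , Dⱼ   , _ = ⊥-elim (¬Dⱼ Dⱼ)
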